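{- Let $j,m$ be positive integers, $\tau_{j,m}=\frac{j+\sqrt{j^2+4m}}{2}$, and $M\in M_2(\mathbb{Z})$. (a) If $j^2+4m$ is not a perfect square, then $[\tau_{j,m}\ 1]^T$ is a right eigenvector of $M$ if and only if there exist integers $s,t$ with $M=\begin{bmatrix} t+sj & ms\\ s & t\end{bmatrix}$. (b) If $j^2+4m=r^2$ for some positive integer $r$, then $[\tau_{j,m}\ 1]^T$ is a right eigenvector of $M$ if and only if $M=\begin{bmatrix} s & t\\ u & v\end{bmatrix}$ with integers $s,t,u,v$ satisfying $u(j+r)^2+2(v-s)(j+r)-4t=0$. -}

module Defs where

open import Data.Nat as ℕ using (ℕ)
open import Data.Integer as ℤ using (ℤ; +_)
open import Data.Rational as ℚ using (ℚ)
open import Data.Fin using (Fin; zero; suc)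
open import Data.Product using (∃)
open import Relation.Binary.PropositionalEquality using (_≡_)

-- 2x2 integer matrices, M i k = entry in row i, column k.
Mat2 : Set
Mat2 = Fin 2 → Fin 2 → ℤ

IsSquare : ℕ → Set
IsSquare n = ∃ λ k → k ℕ.* k ≡ n

ι : ℤ → ℚ
ι z = z ℚ./ 1

-- The field ℚ(√D) (D not a perfect square), elements x + y·√D with x,y ∈ ℚ.
-- It is the subfield of ℝ generated by √D; equality of elements is
-- componentwise since √D is irrational.

record QD : Set where
  constructor ⟨_,_⟩
  field
    re : ℚ
    im : ℚ

open QD public

_+Q_ : QD → QD → QD
⟨ a , b ⟩ +Q ⟨ c , d ⟩ = ⟨ a ℚ.+ c , b ℚ.+ d ⟩

-- multiplication in ℚ(√D), with √D·√D = D
mulQ : ℕ → QD → QD → QD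
mulQ D ⟨ a , b ⟩ ⟨ c , d ⟩ =
  ⟨ a ℚ.* c ℚ.+ ι (+ D) ℚ.* (b ℚ.* d) , a ℚ.* d ℚ.+ b ℚ.* c ⟩

ιQ : ℤ → QD
ιQ z = ⟨ ι z , ℚ.0ℚ ⟩

-- τ_{j,m} = (j + √(j²+4m))/2 as an element of ℚ(√(j²+4m))
τQ : ℕ → QD
τQ j = ⟨ (+ j) ℚ./ 2 , (+ 1) ℚ./ 2 ⟩

IsEigIrr : (D j : ℕ) → Mat2 → Set
IsEigIrr D j M = ∃ λ (lam : QD) →
  (mulQ D (ιQ (M zero zero)) τ +Q ιQ (M zero (suc zero)) ≡ mulQ D lam τ)
  × (mulQ D (ιQ (M (suc zero) zero)) τ +Q ιQ (M (suc zero) (suc zero)) ≡ lam)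
  where
    τ = τQ j
    open import Data.Product using (_×_)

IsEigRat : (j r : ℕ) → Mat2 → Set
IsEigRat j r M = ∃ λ (lam : ℚ) →
  (ι (M zero zero) ℚ.* τ ℚ.+ ι (M zero (suc zero)) ≡ lam ℚ.* τ)
  × (ι (M (suc zero) zero) ℚ.* τ ℚ.+ ι (M (suc zero) (suc zero)) ≡ lam)
  where
    τ = (+ (j ℕ.+ r)) ℚ./ 2
    open import Data.Product using (_×_)

{-# OPTIONS --safe #-}

-- Write M = [[a, b], [c, d]].  The second row of M [τ 1]ᵀ = λ [τ 1]ᵀ forces λ = c τ + d, so
-- [τ 1]ᵀ is an eigenvector iff a τ + b = (c τ + d) τ.  If √(j² + 4m) is irrational, τ² = j τ + m
-- turns the right-hand side into (d + c j) τ + m c, and comparing coordinates in the basis 1, τ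
-- of ℚ(√(j² + 4m)) gives a = d + c j and b = m c.  If j² + 4m = r², then τ = (j + r)/2 is
-- rational, and multiplying the equation by −4 clears denominators:
-- c (j + r)² + 2 (d − a)(j + r) − 4 b = 0.

module Submission where

open import Defs
open import Data.Nat as ℕ using (ℕ; _<_)
open import Data.Integer as ℤ using (ℤ; +_)
import Data.Integer.Properties as ℤ
open import Data.Rational as ℚ using (ℚ; mkℚ; _+_; _*_; -_; _-_; 0ℚ; ½; -½)
import Data.Rational.Properties as ℚ
open import Data.Rational.Solver using (module +-*-Solver)
open import Data.Nat.Coprimality as Coprime using (1-coprimeTo)
open import Algebra.Properties.Group ℚ.+-0-group using (∙-cancelˡ; inverseˡ-unique)
open import Data.Fin using (zero; suc)
open import Data.Product using (∃; _×_; ∃-syntax; _,_)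
open import Data.Product.Function.NonDependent.Propositional using (_×-⇔_)
open import Function.Bundles using (_⇔_; mk⇔)
open import Function.Related.Propositional using (module EquationalReasoning)
open import Relation.Nullary using (¬_)
open import Relation.Binary.PropositionalEquality
open +-*-Solver using (solve; _:+_; _:*_; _:-_; con; _:=_)

ι≡mkℚ : ∀ z → ι z ≡ mkℚ z 0 (Coprime.sym (1-coprimeTo ℤ.∣ z ∣))
ι≡mkℚ z = ℚ.↥p/↧p≡p _

ι-homo-+ : ∀ x y → ι (x ℤ.+ y) ≡ ι x + ι y
ι-homo-+ x y rewrite ι≡mkℚ x | ι≡mkℚ y =
  cong (ℚ._/ 1) (sym (cong₂ ℤ._+_ (ℤ.*-identityʳ x) (ℤ.*-identityʳ y)))

ι-homo-* : ∀ x y → ι (x ℤ.* y) ≡ ι x * ι y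
ι-homo-* x y rewrite ι≡mkℚ x | ι≡mkℚ y = refl

ι-homo‿- : ∀ x → ι (ℤ.- x) ≡ - ι x
ι-homo‿- x = inverseˡ-unique (ι (ℤ.- x)) (ι x)
  (trans (sym (ι-homo-+ (ℤ.- x) x)) (cong ι (ℤ.+-inverseˡ x)))

ι-homo-minus : ∀ x y → ι (x ℤ.- y) ≡ ι x - ι y
ι-homo-minus x y = trans (ι-homo-+ x (ℤ.- y)) (cong (λ z → ι x + z) (ι-homo‿- y))

ι-injective : ∀ {x y} → ι x ≡ ι y → x ≡ y
ι-injective {x} {y} eq = cong ℚ.↥_ (trans (sym (ι≡mkℚ x)) (trans eq (ι≡mkℚ y)))

ι-reflects-≡ : ∀ {x y p q} → ι x ≡ p → ι y ≡ q → (p ≡ q) ⇔ (x ≡ y)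
ι-reflects-≡ refl refl = mk⇔ ι-injective (cong ι)

/2≡ι*½ : ∀ z → z ℚ./ 2 ≡ ι z * ½
/2≡ι*½ z rewrite ι≡mkℚ z = cong (ℚ._/ 2) (sym (ℤ.*-identityʳ z))

*½-injective : ∀ {x y} → x * ½ ≡ y * ½ → x ≡ y
*½-injective {x} {y} eq = begin
  x               ≡⟨ twice-half x ⟩
  x * ½ * ι (+ 2) ≡⟨ cong (_* ι (+ 2)) eq ⟩
  y * ½ * ι (+ 2) ≡⟨ twice-half y ⟨
  y               ∎
  where
  open ≡-Reasoning
  twice-half : ∀ z → z ≡ z * ½ * ι (+ 2)
  twice-half = solve 1 (λ z → z := z :* con ½ :* con (ι (+ 2))) refl

eigenvalue-elimination : ∀ {A B : Set} {f : A → B} {x : B} {y : A} →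
  (∃ λ l → x ≡ f l × y ≡ l) ⇔ (x ≡ f y)
eigenvalue-elimination = mk⇔ (λ { (_ , eq , refl) → eq }) (λ eq → _ , eq , refl)

fromℚ : ℚ → QD
fromℚ x = ⟨ x , 0ℚ ⟩

affine : ℕ → ℚ → ℚ → ℚ → QD
affine D T x y = mulQ D (fromℚ x) ⟨ T , ½ ⟩ +Q fromℚ y

affine-coordinates : ∀ D T x y → affine D T x y ≡ ⟨ x * T + y , x * ½ ⟩
affine-coordinates D T x y = cong₂ ⟨_,_⟩
  (solve 4 (λ x y T d → x :* T :+ d :* (con 0ℚ :* con ½) :+ y := x :* T :+ y) refl x y T (ι (+ D)))
  (solve 2 (λ x T → x :* con ½ :+ con 0ℚ :* T :+ con 0ℚ := x :* con ½) refl x T)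

-- Irrationality of √D is used only here, through the componentwise equality of QD.
affine-injective : ∀ {D T x y x′ y′} →
  affine D T x y ≡ affine D T x′ y′ → x ≡ x′ × y ≡ y′
affine-injective {D} {T} {x} {y} {x′} {y′} eq = x≡x′ , ∙-cancelˡ (x * T) y y′ re-equal
  where
  coordinates-equal : ⟨ x * T + y , x * ½ ⟩ ≡ ⟨ x′ * T + y′ , x′ * ½ ⟩
  coordinates-equal = trans (sym (affine-coordinates D T x y)) (trans eq (affine-coordinates D T x′ y′))
  x≡x′ : x ≡ x′
  x≡x′ = *½-injective (cong im coordinates-equal)
  re-equal : x * T + y ≡ x * T + y′
  re-equal = trans (cong re coordinates-equal) (cong (λ z → z * T + y′) (sym x≡x′))

-- τ = (J + √D)/2 satisfies τ² = J τ + M.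
τ-root : ∀ D J M {T} → T ≡ J * ½ → ι (+ D) ≡ J * J + ι (+ 4) * M → ∀ c e →
  mulQ D (affine D T c e) ⟨ T , ½ ⟩ ≡ affine D T (e + c * J) (M * c)
τ-root D J M refl D≡ c e = begin
  mulQ D (affine D T c e) τ
    ≡⟨ cong (λ z → mulQ D z τ) (affine-coordinates D T c e) ⟩
  ⟨ (c * T + e) * T + ι (+ D) * (c * ½ * ½) , (c * T + e) * ½ + c * ½ * T ⟩
    ≡⟨ cong₂ ⟨_,_⟩ (cong (λ δ → (c * T + e) * T + δ * (c * ½ * ½)) D≡) refl ⟩
  ⟨ (c * T + e) * T + (J * J + ι (+ 4) * M) * (c * ½ * ½) , (c * T + e) * ½ + c * ½ * T ⟩
    ≡⟨ cong₂ ⟨_,_⟩ real imaginary ⟩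
  ⟨ (e + c * J) * T + M * c , (e + c * J) * ½ ⟩
    ≡⟨ affine-coordinates D T (e + c * J) (M * c) ⟨
  affine D T (e + c * J) (M * c) ∎
  where
  open ≡-Reasoning
  T : ℚ
  T = J * ½
  τ : QD
  τ = ⟨ T , ½ ⟩
  real : (c * T + e) * T + (J * J + ι (+ 4) * M) * (c * ½ * ½) ≡ (e + c * J) * T + M * c
  real = solve 4 (λ c e J M →
      (c :* (J :* con ½) :+ e) :* (J :* con ½) :+ (J :* J :+ con (ι (+ 4)) :* M) :* (c :* con ½ :* con ½)
    := (e :+ c :* J) :* (J :* con ½) :+ M :* c) refl c e J M
  imaginary : (c * T + e) * ½ + c * ½ * T ≡ (e + c * J) * ½
  imaginary = solve 3 (λ c e J →
      (c :* (J :* con ½) :+ e) :* con ½ :+ c :* con ½ :* (J :* con ½)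
    := (e :+ c :* J) :* con ½) refl c e J

irrational-eigen-equation : ∀ D J M {T} → T ≡ J * ½ → ι (+ D) ≡ J * J + ι (+ 4) * M →
  ∀ a b c d →
  (affine D T a b ≡ mulQ D (affine D T c d) ⟨ T , ½ ⟩) ⇔ (a ≡ d + c * J × b ≡ M * c)
irrational-eigen-equation D J M T≡ D≡ a b c d = mk⇔
  (λ eq → affine-injective {D} (trans eq (τ-root D J M T≡ D≡ c d)))
  (λ { (refl , refl) → sym (τ-root D J M T≡ D≡ c d) })

rational-eigen-equation : ∀ R {τ} → τ ≡ R * ½ → ∀ a b c d →
  (a * τ + b ≡ (c * τ + d) * τ) ⇔ (c * R * R + ι (+ 2) * (d - a) * R - ι (+ 4) * b ≡ 0ℚ)
rational-eigen-equation R refl a b c d = mk⇔ quadratic-vanishes eigen-equation-holds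
  where
  open ≡-Reasoning
  τ lhs rhs Q : ℚ
  τ = R * ½
  lhs = a * τ + b
  rhs = (c * τ + d) * τ
  Q = c * R * R + ι (+ 2) * (d - a) * R - ι (+ 4) * b
  Q≡-4[lhs-rhs] : Q ≡ - ι (+ 4) * (lhs - rhs)
  Q≡-4[lhs-rhs] = solve 5 (λ a b c d R →
      c :* R :* R :+ con (ι (+ 2)) :* (d :- a) :* R :- con (ι (+ 4)) :* b
    := con (- ι (+ 4)) :* ((a :* (R :* con ½) :+ b) :- (c :* (R :* con ½) :+ d) :* (R :* con ½)))
    refl a b c d R
  lhs≡rhs-Q/4 : lhs ≡ rhs + -½ * ½ * Q
  lhs≡rhs-Q/4 = solve 5 (λ a b c d R →
      a :* (R :* con ½) :+ b
    := (c :* (R :* con ½) :+ d) :* (R :* con ½)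
       :+ con (-½ * ½) :* (c :* R :* R :+ con (ι (+ 2)) :* (d :- a) :* R :- con (ι (+ 4)) :* b))
    refl a b c d R
  quadratic-vanishes : lhs ≡ rhs → Q ≡ 0ℚ
  quadratic-vanishes eq = begin
    Q                       ≡⟨ Q≡-4[lhs-rhs] ⟩
    - ι (+ 4) * (lhs - rhs) ≡⟨ cong (λ z → - ι (+ 4) * (z - rhs)) eq ⟩
    - ι (+ 4) * (rhs - rhs) ≡⟨ cong (- ι (+ 4) *_) (ℚ.+-inverseʳ rhs) ⟩
    - ι (+ 4) * 0ℚ          ≡⟨ ℚ.*-zeroʳ (- ι (+ 4)) ⟩
    0ℚ                      ∎
  eigen-equation-holds : Q ≡ 0ℚ → lhs ≡ rhs
  eigen-equation-holds Q≡0 = begin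
    lhs                ≡⟨ lhs≡rhs-Q/4 ⟩
    rhs + -½ * ½ * Q   ≡⟨ cong (λ z → rhs + -½ * ½ * z) Q≡0 ⟩
    rhs + -½ * ½ * 0ℚ  ≡⟨ cong (λ z → rhs + z) (ℚ.*-zeroʳ (-½ * ½)) ⟩
    rhs + 0ℚ           ≡⟨ ℚ.+-identityʳ rhs ⟩
    rhs                ∎

ι-homo-quadratic : ∀ a b c d R →
  ι (c ℤ.* R ℤ.* R ℤ.+ + 2 ℤ.* (d ℤ.- a) ℤ.* R ℤ.- + 4 ℤ.* b)
    ≡ ι c * ι R * ι R + ι (+ 2) * (ι d - ι a) * ι R - ι (+ 4) * ι b
ι-homo-quadratic a b c d R = begin
  ι (c ℤ.* R ℤ.* R ℤ.+ + 2 ℤ.* (d ℤ.- a) ℤ.* R ℤ.- + 4 ℤ.* b)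
    ≡⟨ ι-homo-minus (c ℤ.* R ℤ.* R ℤ.+ + 2 ℤ.* (d ℤ.- a) ℤ.* R) (+ 4 ℤ.* b) ⟩
  ι (c ℤ.* R ℤ.* R ℤ.+ + 2 ℤ.* (d ℤ.- a) ℤ.* R) - ι (+ 4 ℤ.* b)
    ≡⟨ cong₂ _-_ (ι-homo-+ (c ℤ.* R ℤ.* R) (+ 2 ℤ.* (d ℤ.- a) ℤ.* R)) (ι-homo-* (+ 4) b) ⟩
  ι (c ℤ.* R ℤ.* R) + ι (+ 2 ℤ.* (d ℤ.- a) ℤ.* R) - ι (+ 4) * ι b
    ≡⟨ cong₂ (λ x y → x + y - ι (+ 4) * ι b)
             (ι-homo-* (c ℤ.* R) R) (ι-homo-* (+ 2 ℤ.* (d ℤ.- a)) R) ⟩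
  ι (c ℤ.* R) * ι R + ι (+ 2 ℤ.* (d ℤ.- a)) * ι R - ι (+ 4) * ι b
    ≡⟨ cong₂ (λ x y → x * ι R + y * ι R - ι (+ 4) * ι b)
             (ι-homo-* c R) (ι-homo-* (+ 2) (d ℤ.- a)) ⟩
  ι c * ι R * ι R + ι (+ 2) * ι (d ℤ.- a) * ι R - ι (+ 4) * ι b
    ≡⟨ cong (λ x → ι c * ι R * ι R + ι (+ 2) * x * ι R - ι (+ 4) * ι b) (ι-homo-minus d a) ⟩
  ι c * ι R * ι R + ι (+ 2) * (ι d - ι a) * ι R - ι (+ 4) * ι b ∎
  where open ≡-Reasoning

irrational-case : ∀ j m (M : Mat2) →
  IsEigIrr (j ℕ.* j ℕ.+ 4 ℕ.* m) j M
    ⇔ (∃[ s ] ∃[ t ] (M zero zero ≡ t ℤ.+ s ℤ.* + j)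
        × (M zero (suc zero) ≡ + m ℤ.* s)
        × (M (suc zero) zero ≡ s)
        × (M (suc zero) (suc zero) ≡ t))
irrational-case j m M = begin
  IsEigIrr D j M
    ∼⟨ eigenvalue-elimination ⟩
  (affine D T (ι a) (ι b) ≡ mulQ D (affine D T (ι c) (ι d)) (τQ j))
    ∼⟨ irrational-eigen-equation D (ι (+ j)) (ι (+ m)) (/2≡ι*½ (+ j)) radicand
                                 (ι a) (ι b) (ι c) (ι d) ⟩
  (ι a ≡ ι d + ι c * ι (+ j) × ι b ≡ ι (+ m) * ι c)
    ∼⟨ ι-reflects-≡ refl ι-homo-entry ×-⇔ ι-reflects-≡ refl (ι-homo-* (+ m) c) ⟩
  (a ≡ d ℤ.+ c ℤ.* + j × b ≡ + m ℤ.* c)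
    ∼⟨ mk⇔ (λ (a≡ , b≡) → c , d , a≡ , b≡ , refl , refl)
           (λ { (_ , _ , a≡ , b≡ , refl , refl) → a≡ , b≡ }) ⟩
  (∃[ s ] ∃[ t ] (a ≡ t ℤ.+ s ℤ.* + j) × (b ≡ + m ℤ.* s) × (c ≡ s) × (d ≡ t)) ∎
  where
  open EquationalReasoning
  D : ℕ
  D = j ℕ.* j ℕ.+ 4 ℕ.* m
  T : ℚ
  T = + j ℚ./ 2
  a b c d : ℤ
  a = M zero zero
  b = M zero (suc zero)
  c = M (suc zero) zero
  d = M (suc zero) (suc zero)
  radicand : ι (+ D) ≡ ι (+ j) * ι (+ j) + ι (+ 4) * ι (+ m)
  radicand = trans
    (cong ι (trans (ℤ.pos-+ (j ℕ.* j) (4 ℕ.* m)) (cong₂ ℤ._+_ (ℤ.pos-* j j) (ℤ.pos-* 4 m))))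
    (trans (ι-homo-+ (+ j ℤ.* + j) (+ 4 ℤ.* + m))
           (cong₂ _+_ (ι-homo-* (+ j) (+ j)) (ι-homo-* (+ 4) (+ m))))
  ι-homo-entry : ι (d ℤ.+ c ℤ.* + j) ≡ ι d + ι c * ι (+ j)
  ι-homo-entry = trans (ι-homo-+ d (c ℤ.* + j)) (cong (λ x → ι d + x) (ι-homo-* c (+ j)))

rational-case : ∀ j r (M : Mat2) →
  IsEigRat j r M
    ⇔ (∃[ s ] ∃[ t ] ∃[ u ] ∃[ v ] (M zero zero ≡ s)
        × (M zero (suc zero) ≡ t)
        × (M (suc zero) zero ≡ u)
        × (M (suc zero) (suc zero) ≡ v)
        × (u ℤ.* (+ (j ℕ.+ r)) ℤ.* (+ (j ℕ.+ r))
            ℤ.+ + 2 ℤ.* (v ℤ.- s) ℤ.* (+ (j ℕ.+ r))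
            ℤ.- + 4 ℤ.* t ≡ + 0))
rational-case j r M = begin
  IsEigRat j r M
    ∼⟨ eigenvalue-elimination ⟩
  (ι a * τ + ι b ≡ (ι c * τ + ι d) * τ)
    ∼⟨ rational-eigen-equation (ι R) (/2≡ι*½ R) (ι a) (ι b) (ι c) (ι d) ⟩
  (ι c * ι R * ι R + ι (+ 2) * (ι d - ι a) * ι R - ι (+ 4) * ι b ≡ 0ℚ)
    ∼⟨ ι-reflects-≡ (ι-homo-quadratic a b c d R) refl ⟩
  (c ℤ.* R ℤ.* R ℤ.+ + 2 ℤ.* (d ℤ.- a) ℤ.* R ℤ.- + 4 ℤ.* b ≡ + 0)
    ∼⟨ mk⇔ (λ E≡0 → a , b , c , d , refl , refl , refl , refl , E≡0)
           (λ { (_ , _ , _ , _ , refl , refl , refl , refl , E≡0) → E≡0 }) ⟩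
  (∃[ s ] ∃[ t ] ∃[ u ] ∃[ v ] (a ≡ s) × (b ≡ t) × (c ≡ u) × (d ≡ v)
    × (u ℤ.* R ℤ.* R ℤ.+ + 2 ℤ.* (v ℤ.- s) ℤ.* R ℤ.- + 4 ℤ.* t ≡ + 0)) ∎
  where
  open EquationalReasoning
  R : ℤ
  R = + (j ℕ.+ r)
  τ : ℚ
  τ = R ℚ./ 2
  a b c d : ℤ
  a = M zero zero
  b = M zero (suc zero)
  c = M (suc zero) zero
  d = M (suc zero) (suc zero)

theorem4p26 : (j m : ℕ) → 0 < j → 0 < m → (M : Mat2) →
    ((¬ IsSquare (j ℕ.* j ℕ.+ 4 ℕ.* m)) →
      (IsEigIrr (j ℕ.* j ℕ.+ 4 ℕ.* m) j M
        ⇔ (∃[ s ] ∃[ t ] (M zero zero ≡ t ℤ.+ s ℤ.* + j)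
            × (M zero (suc zero) ≡ + m ℤ.* s)
            × (M (suc zero) zero ≡ s)
            × (M (suc zero) (suc zero) ≡ t))))
    × ((r : ℕ) → 0 < r → r ℕ.* r ≡ j ℕ.* j ℕ.+ 4 ℕ.* m →
      (IsEigRat j r M
        ⇔ (∃[ s ] ∃[ t ] ∃[ u ] ∃[ v ] (M zero zero ≡ s)
            × (M zero (suc zero) ≡ t)
            × (M (suc zero) zero ≡ u)
            × (M (suc zero) (suc zero) ≡ v)
            × (u ℤ.* (+ (j ℕ.+ r)) ℤ.* (+ (j ℕ.+ r))
                ℤ.+ + 2 ℤ.* (v ℤ.- s) ℤ.* (+ (j ℕ.+ r))
                ℤ.- + 4 ℤ.* t ≡ + 0))))
theorem4p26 j m _ _ M = (λ _ → irrational-case j m M) , (λ r _ _ → rational-case j r M)
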